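{- Let $T$ be a tree of odd order and let $v$ be a pendant vertex of $T$. Then $\sigma^{ - }(T)\leq \sigma^{ - }(T-v)$.
   Context: For a connected simple graph $G$ of order $p$, a parity labelling is a bijection $f:V(G)\to\{1,\ldots,p\}$; an edge $uv$ is negative if $f(u),f(v)$ have opposite parity. The rna number $\sigma^{ - }(G)$ is the minimum over all such $f$ of the number of negative edges. -}

module Defs where

open import Data.Nat using (ℕ; zero; suc; _<ᵇ_; _≡ᵇ_; _%_; _≤_; _+_; _*_)
open import Data.Bool using (Bool; true; false; _∧_; not; T)
open import Data.Fin using (Fin; toℕ; punchIn)
open import Data.List using (List; []; _∷_; length; filter; allFin; concatMap; map)
open import Data.List.Relation.Unary.Unique.Propositional using (Unique)
open import Data.Product using (Σ; _×_; _,_; ∃; proj₁; proj₂)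
open import Data.Fin.Permutation using (Permutation′; _⟨$⟩ʳ_)
open import Relation.Binary.PropositionalEquality using (_≡_)
open import Relation.Nullary using (¬_)
open import Data.Unit using (⊤)
open import Data.Empty using (⊥)

record Graph (n : ℕ) : Set where
  field
    adj    : Fin n → Fin n → Bool
    sym    : ∀ i j → adj i j ≡ adj j i
    irrefl : ∀ i → adj i i ≡ false
open Graph public

countB : {A : Set} → (A → Bool) → List A → ℕ
countB p []       = 0
countB p (x ∷ xs) with p x
... | true  = suc (countB p xs)
... | false = countB p xs

allPairs : (n : ℕ) → List (Fin n × Fin n)
allPairs n = concatMap (λ i → map (λ j → (i , j)) (allFin n)) (allFin n)

degree : ∀ {n} → Graph n → Fin n → ℕ
degree {n} G v = countB (λ j → adj G v j) (allFin n)

data Walk {n : ℕ} (G : Graph n) : Fin n → Fin n → Set where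
  [] : ∀ {u} → Walk G u u
  _∷_ : ∀ {u v w} → T (adj G u v) → Walk G v w → Walk G u w

Connected : ∀ {n} → Graph n → Set
Connected G = ∀ u v → Walk G u v

Chain : ∀ {n} → Graph n → List (Fin n) → Set
Chain G []             = ⊤
Chain G (x ∷ [])       = ⊤
Chain G (x ∷ y ∷ xs)   = T (adj G x y) × Chain G (y ∷ xs)

last : ∀ {n} → Fin n → List (Fin n) → Fin n
last x []       = x
last x (y ∷ ys) = last y ys

Cycle : ∀ {n} → Graph n → List (Fin n) → Set
Cycle G []           = ⊥
Cycle G (x ∷ xs)     =
  (3 ≤ length (x ∷ xs)) × Unique (x ∷ xs) × Chain G (x ∷ xs) × T (adj G (last x xs) x)

Acyclic : ∀ {n} → Graph n → Set
Acyclic G = ∀ c → ¬ Cycle G c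

IsTree : ∀ {n} → Graph n → Set
IsTree G = Connected G × Acyclic G

Pendant : ∀ {n} → Graph n → Fin n → Set
Pendant G v = degree G v ≡ 1

deleteVertex : ∀ {m} → Graph (suc m) → Fin (suc m) → Graph m
deleteVertex G v = record
  { adj    = λ i j → adj G (punchIn v i) (punchIn v j)
  ; sym    = λ i j → sym G (punchIn v i) (punchIn v j)
  ; irrefl = λ i → irrefl G (punchIn v i)
  }

-- parity labelling: a bijection f : V(G) → {1,…,p}; we use labels 0,…,p-1
-- (f(u) ↦ f(u) - 1 preserves "opposite parity").
oppParity : ℕ → ℕ → Bool
oppParity a b = not ((a % 2) ≡ᵇ (b % 2))

-- number of negative edges of G under labelling f (each edge {u,v} counted
-- once via the ordered pair with u < v)
negEdges : ∀ {n} → Graph n → Permutation′ n → ℕ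
negEdges {n} G f =
  countB (λ p → (toℕ (proj₁ p) <ᵇ toℕ (proj₂ p)) ∧ adj G (proj₁ p) (proj₂ p)
                ∧ oppParity (toℕ (f ⟨$⟩ʳ proj₁ p)) (toℕ (f ⟨$⟩ʳ proj₂ p)))
         (allPairs n)

-- k is the rna number σ⁻(G): it is attained and is a lower bound
IsRna : ∀ {n} → Graph n → ℕ → Set
IsRna G k = (∃ λ f → negEdges G f ≡ k) × (∀ f → k ≤ negEdges G f)

-- A labelling of T - v uses the labels 0, …, n - 1 with n even, and v has a single
-- neighbour u. Give v the label n when the label of u is even, and the label 0,
-- shifting all other labels up by one, when it is odd. Either way v gets the parity
-- of u, so no new negative edge appears, and a uniform shift preserves which pairs
-- have opposite parity. Hence every labelling of T - v extends to one of T with as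
-- many negative edges; only the pendancy of v and the parity of the order are used,
-- not that T is a tree.
module Submission where

open import Defs
open import Data.Nat using (ℕ; suc; _*_; _≤_)
open import Data.Fin using (Fin)
open import Relation.Binary.PropositionalEquality using (_≡_)

open import Data.Nat using (zero; _+_; _<ᵇ_; _≡ᵇ_; _%_)
open import Data.Nat.Properties using (suc-injective; *-comm; +-0-commutativeMonoid)
open import Data.Nat.DivMod using (m*n%n≡0)
open import Data.Fin as Fin using (toℕ; punchIn; punchOut; fromℕ; _≟_)
open import Data.Fin.Properties using (punchIn-punchOut; toℕ-fromℕ)
open import Data.Fin.Permutation using (Permutation; Permutation′; _⟨$⟩ʳ_; insert; insert-punchIn)
open import Data.Bool using (Bool; true; false; _∧_; not; if_then_else_)
open import Data.List using (List; []; _∷_; _++_; map; tabulate; allFin; concatMap)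
open import Data.List.Properties using (map-tabulate)
open import Data.List.Membership.Propositional using (_∈_)
open import Data.List.Membership.Propositional.Properties using (∈-allFin)
open import Data.List.Relation.Unary.Any using (here; there)
open import Data.Product using (_×_; _,_; ∃)
open import Function using (id; _∘_)
open import Relation.Nullary using (¬_; yes; no; contradiction)
open import Relation.Binary.PropositionalEquality as ≡
  using (refl; trans; cong; cong₂; subst; module ≡-Reasoning)
open import Algebra.Properties.CommutativeMonoid.Sum +-0-commutativeMonoid
  using (sum-syntax; sum-remove; sum-cong-≗; sum-replicate-zero)

indicator : Bool → ℕ
indicator b = if b then 1 else 0

countB-++ : ∀ {A : Set} (p : A → Bool) xs ys →
  countB p (xs ++ ys) ≡ countB p xs + countB p ys
countB-++ p []       ys = refl
countB-++ p (x ∷ xs) ys with p x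
... | true  = cong suc (countB-++ p xs ys)
... | false = countB-++ p xs ys

countB-tabulate : ∀ {A : Set} {n} (p : A → Bool) (f : Fin n → A) →
  countB p (tabulate f) ≡ ∑[ i < n ] indicator (p (f i))
countB-tabulate {n = zero}  p f = refl
countB-tabulate {n = suc n} p f with p (f Fin.zero)
... | true  = cong suc (countB-tabulate p (f ∘ Fin.suc))
... | false = countB-tabulate p (f ∘ Fin.suc)

countB-concatMap-tabulate : ∀ {A B : Set} {n} (p : B → Bool) (g : A → List B) (f : Fin n → A) →
  countB p (concatMap g (tabulate f)) ≡ ∑[ i < n ] countB p (g (f i))
countB-concatMap-tabulate {n = zero}  p g f = refl
countB-concatMap-tabulate {n = suc n} p g f =
  trans (countB-++ p (g (f Fin.zero)) _)
        (cong (countB p (g (f Fin.zero)) +_) (countB-concatMap-tabulate p g (f ∘ Fin.suc)))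

countB-allPairs : ∀ {n} (p : Fin n × Fin n → Bool) →
  countB p (allPairs n) ≡ ∑[ i < n ] ∑[ j < n ] indicator (p (i , j))
countB-allPairs {n} p =
  trans (countB-concatMap-tabulate p (λ i → map (i ,_) (allFin n)) id)
        (sum-cong-≗ λ i → trans (cong (countB p) (map-tabulate id (i ,_)))
                                (countB-tabulate p (i ,_)))

countB≡0⇒false : ∀ {A : Set} (p : A → Bool) {xs y} → countB p xs ≡ 0 → y ∈ xs → p y ≡ false
countB≡0⇒false p {x ∷ xs} eq (here refl) with p x
... | false = refl
countB≡0⇒false p {x ∷ xs} eq (there y∈xs) with p x
... | false = countB≡0⇒false p eq y∈xs

countB≡1⇒∃! : ∀ {A : Set} (p : A → Bool) xs → countB p xs ≡ 1 →
  ∃ λ x → p x ≡ true × ∀ {y} → y ∈ xs → p y ≡ true → y ≡ x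
countB≡1⇒∃! p (x ∷ xs) eq with p x in px
... | true  = x , px , λ
  { (here refl)  _  → refl
  ; (there y∈xs) py →
      contradiction (trans (≡.sym py) (countB≡0⇒false p (suc-injective eq) y∈xs)) λ ()
  }
... | false with countB≡1⇒∃! p xs eq
...   | z , pz , unique = z , pz , λ
  { (here refl)  py → contradiction (trans (≡.sym px) py) λ ()
  ; (there y∈xs) py → unique y∈xs py
  }

pendant⇒uniqueNeighbour : ∀ {n} (G : Graph n) {v} → Pendant G v →
  ∃ λ u → adj G v u ≡ true × ∀ w → adj G v w ≡ true → w ≡ u
pendant⇒uniqueNeighbour G pendant with countB≡1⇒∃! _ _ pendant
... | u , vu , unique = u , vu , λ w → unique (∈-allFin w)

-- Each `oppParity` lemma is a finite check, since `suc (suc a) % 2` reduces to `a % 2`.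
oppParity-comm : ∀ a b → oppParity a b ≡ oppParity b a
oppParity-comm 0 0 = refl
oppParity-comm 0 1 = refl
oppParity-comm 1 0 = refl
oppParity-comm 1 1 = refl
oppParity-comm (suc (suc a)) b = oppParity-comm a b
oppParity-comm a (suc (suc b)) = oppParity-comm a b

oppParity-sucʳ : ∀ a b → oppParity a (suc b) ≡ not (oppParity a b)
oppParity-sucʳ 0 0 = refl
oppParity-sucʳ 0 1 = refl
oppParity-sucʳ 1 0 = refl
oppParity-sucʳ 1 1 = refl
oppParity-sucʳ (suc (suc a)) b = oppParity-sucʳ a b
oppParity-sucʳ a (suc (suc b)) = oppParity-sucʳ a b

oppParity-suc : ∀ a b → oppParity (suc a) (suc b) ≡ oppParity a b
oppParity-suc 0 0 = refl
oppParity-suc 0 1 = refl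
oppParity-suc 1 0 = refl
oppParity-suc 1 1 = refl
oppParity-suc (suc (suc a)) b = oppParity-suc a b
oppParity-suc a (suc (suc b)) = oppParity-suc a b

oppParity-congˡ : ∀ a a′ b → a % 2 ≡ a′ % 2 → oppParity a b ≡ oppParity a′ b
oppParity-congˡ a a′ b eq = cong (λ r → not (r ≡ᵇ b % 2)) eq

∧-∧≡false : ∀ a b c → (b ≡ true → c ≡ false) → a ∧ b ∧ c ≡ false
∧-∧≡false false _     _ _       = refl
∧-∧≡false true  false _ _       = refl
∧-∧≡false true  true  _ c≡false = c≡false refl

<ᵇ-punchIn : ∀ {n} (v : Fin (suc n)) (i j : Fin n) →
  (toℕ (punchIn v i) <ᵇ toℕ (punchIn v j)) ≡ (toℕ i <ᵇ toℕ j)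
<ᵇ-punchIn Fin.zero     i            j            = refl
<ᵇ-punchIn (Fin.suc v) Fin.zero     Fin.zero     = refl
<ᵇ-punchIn (Fin.suc v) Fin.zero     (Fin.suc j) = refl
<ᵇ-punchIn (Fin.suc v) (Fin.suc i) Fin.zero     = refl
<ᵇ-punchIn (Fin.suc v) (Fin.suc i) (Fin.suc j) = <ᵇ-punchIn v i j

toℕ-punchIn-fromℕ : ∀ n (x : Fin n) → toℕ (punchIn (fromℕ n) x) ≡ toℕ x
toℕ-punchIn-fromℕ (suc n) Fin.zero     = refl
toℕ-punchIn-fromℕ (suc n) (Fin.suc x) = cong suc (toℕ-punchIn-fromℕ n x)

insert-self : ∀ {m n} (i : Fin (suc m)) (j : Fin (suc n)) (π : Permutation m n) →
  insert i j π ⟨$⟩ʳ i ≡ j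
insert-self i j π with i ≟ i
... | yes _   = refl
... | no  i≢i = contradiction refl i≢i

label : ∀ {n} → Permutation′ n → Fin n → ℕ
label f x = toℕ (f ⟨$⟩ʳ x)

negativePair : ∀ {n} → Graph n → Permutation′ n → Fin n × Fin n → Bool
negativePair G f (i , j) = (toℕ i <ᵇ toℕ j) ∧ adj G i j ∧ oppParity (label f i) (label f j)

NoNegativeEdgeAt : ∀ {n} → Graph n → Permutation′ n → Fin n → Set
NoNegativeEdgeAt G f v = ∀ w → adj G v w ≡ true → oppParity (label f v) (label f w) ≡ false

negEdges-deleteVertex : ∀ {n} (G : Graph (suc n)) (v : Fin (suc n))
  (f : Permutation′ (suc n)) (h : Permutation′ n) → NoNegativeEdgeAt G f v →
  (∀ x y → oppParity (label f (punchIn v x)) (label f (punchIn v y))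
         ≡ oppParity (label h x) (label h y)) →
  negEdges G f ≡ negEdges (deleteVertex G v) h
negEdges-deleteVertex {n} G v f h noNegAtV agree = begin
  negEdges G f
    ≡⟨ countB-allPairs P ⟩
  ∑[ i < suc n ] ∑[ j < suc n ] indicator (P (i , j))
    ≡⟨ sum-remove {i = v} (λ i → ∑[ j < suc n ] indicator (P (i , j))) ⟩
  ∑[ j < suc n ] indicator (P (v , j)) + ∑[ i < n ] ∑[ j < suc n ] indicator (P (punchIn v i , j))
    ≡⟨ cong₂ _+_ rowV (sum-cong-≗ rowPunchIn) ⟩
  ∑[ i < n ] ∑[ j < n ] indicator (P′ (i , j))
    ≡⟨ ≡.sym (countB-allPairs P′) ⟩
  negEdges (deleteVertex G v) h
    ∎
  where
  open ≡-Reasoning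
  P = negativePair G f
  P′ = negativePair (deleteVertex G v) h

  fromV : ∀ j → P (v , j) ≡ false
  fromV j = ∧-∧≡false (toℕ v <ᵇ toℕ j) (adj G v j) _ (noNegAtV j)

  toV : ∀ i → P (punchIn v i , v) ≡ false
  toV i = ∧-∧≡false (toℕ (punchIn v i) <ᵇ toℕ v) (adj G (punchIn v i) v) _ λ adj≡true →
    trans (oppParity-comm (label f (punchIn v i)) (label f v))
          (noNegAtV (punchIn v i) (trans (Graph.sym G v (punchIn v i)) adj≡true))

  inside : ∀ i j → P (punchIn v i , punchIn v j) ≡ P′ (i , j)
  inside i j = cong₂ (λ lt opp → lt ∧ adj G (punchIn v i) (punchIn v j) ∧ opp)
    (<ᵇ-punchIn v i j) (agree i j)

  rowV : ∑[ j < suc n ] indicator (P (v , j)) ≡ 0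
  rowV = trans (sum-cong-≗ (cong indicator ∘ fromV)) (sum-replicate-zero (suc n))

  rowPunchIn : ∀ i → ∑[ j < suc n ] indicator (P (punchIn v i , j))
                   ≡ ∑[ j < n ] indicator (P′ (i , j))
  rowPunchIn i = trans (sum-remove {i = v} (λ j → indicator (P (punchIn v i , j))))
    (cong₂ _+_ (cong indicator (toV i)) (sum-cong-≗ (cong indicator ∘ inside i)))

negEdges-insert : ∀ {n} (G : Graph (suc n)) (v j : Fin (suc n)) (h : Permutation′ n) (u : Fin n) →
  (∀ w → adj G v w ≡ true → w ≡ punchIn v u) →
  oppParity (toℕ j) (toℕ (punchIn j (h ⟨$⟩ʳ u))) ≡ false →
  (∀ x y → oppParity (toℕ (punchIn j x)) (toℕ (punchIn j y)) ≡ oppParity (toℕ x) (toℕ y)) →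
  negEdges G (insert v j h) ≡ negEdges (deleteVertex G v) h
negEdges-insert G v j h u neighbour sameParity shiftInvariant =
  negEdges-deleteVertex G v f h noNegAtV agree
  where
  f = insert v j h

  label-punchIn : ∀ x → label f (punchIn v x) ≡ toℕ (punchIn j (h ⟨$⟩ʳ x))
  label-punchIn x = cong toℕ (insert-punchIn v j h x)

  noNegAtV : NoNegativeEdgeAt G f v
  noNegAtV w vw = trans
    (cong₂ oppParity (cong toℕ (insert-self v j h))
                     (trans (cong (label f) (neighbour w vw)) (label-punchIn u)))
    sameParity

  agree : ∀ x y → oppParity (label f (punchIn v x)) (label f (punchIn v y))
                 ≡ oppParity (label h x) (label h y)
  agree x y = trans (cong₂ oppParity (label-punchIn x) (label-punchIn y)) (shiftInvariant _ _)

negEdges-extend-singleNeighbour : ∀ {n} → n % 2 ≡ 0 → (G : Graph (suc n)) (v : Fin (suc n)) (u : Fin n) →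
  (∀ w → adj G v w ≡ true → w ≡ punchIn v u) →
  (h : Permutation′ n) → ∃ λ f → negEdges G f ≡ negEdges (deleteVertex G v) h
negEdges-extend-singleNeighbour {n} n-even G v u neighbour h with oppParity 0 (label h u) in parity
... | false = insert v (fromℕ n) h , negEdges-insert G v (fromℕ n) h u neighbour
  (trans (cong₂ oppParity (toℕ-fromℕ n) (toℕ-punchIn-fromℕ n _))
         (trans (oppParity-congˡ n 0 (label h u) n-even) parity))
  (λ x y → cong₂ oppParity (toℕ-punchIn-fromℕ n x) (toℕ-punchIn-fromℕ n y))
... | true = insert v Fin.zero h , negEdges-insert G v Fin.zero h u neighbour
  (trans (oppParity-sucʳ 0 (label h u)) (cong not parity))
  (λ x y → oppParity-suc (toℕ x) (toℕ y))

negEdges-extend-pendant : ∀ {n} → n % 2 ≡ 0 → (G : Graph (suc n)) (v : Fin (suc n)) → Pendant G v →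
  (h : Permutation′ n) → ∃ λ f → negEdges G f ≡ negEdges (deleteVertex G v) h
negEdges-extend-pendant n-even G v pendant with pendant⇒uniqueNeighbour G pendant
... | u , vu , unique = negEdges-extend-singleNeighbour n-even G v (punchOut v≢u) neighbour
  where
  v≢u : ¬ v ≡ u
  v≢u refl = contradiction (trans (≡.sym vu) (irrefl G v)) λ ()

  neighbour : ∀ w → adj G v w ≡ true → w ≡ punchIn v (punchOut v≢u)
  neighbour w vw = trans (unique w vw) (≡.sym (punchIn-punchOut v≢u))

mainTheorem5 : (m : ℕ) (n : ℕ) → n ≡ 2 * m → (T : Graph (suc n)) → IsTree T →
    (v : Fin (suc n)) → Pendant T v →
    (a b : ℕ) → IsRna T a → IsRna (deleteVertex T v) b → a ≤ b
mainTheorem5 m _ refl T _ v pendant a b (_ , a≤) ((g , g≡b) , _) =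
  let f , f≡g = negEdges-extend-pendant 2m-even T v pendant g
  in  subst (a ≤_) (trans f≡g g≡b) (a≤ f)
  where
  2m-even : 2 * m % 2 ≡ 0
  2m-even = trans (cong (_% 2) (*-comm 2 m)) (m*n%n≡0 m 2)
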